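{- Let $\mathbf{ILX}$ be a logic extending $\mathbf{IL}$, $\Gamma,\Delta$ $\mathbf{ILX}$-MCSs and $S$ an $\mathbf{ILX}$-theory with $\Gamma\prec_S\Delta$. Then there exists an $\mathbf{ILX}$-theory $S'\supseteq S$ with $\Gamma\prec_{S'}\Delta$ which is maximal (with respect to inclusion) among $\mathbf{ILX}$-theories $U$ with $\Gamma\prec_U\Delta$.
   Context: Formulas: $\bot$, propositional variables, $\to$, $\Box$, binary $\rhd$; $\Diamond A:=\neg\Box\neg A$. $\mathbf{IL}$: classical tautologies, K, L: $\Box(\Box A\to A)\to\Box A$, J1: $\Box(A\to B)\to A\rhd B$, J2: $(A\rhd B)\wedge(B\rhd C)\to A\rhd C$, J3: $(A\rhd C)\wedge(B\rhd C)\to A\vee B\rhd C$, J4: $A\rhd B\to(\Diamond A\to\Diamond B)$, J5: $\Diamond A\rhd A$; rules modus ponens and necessitation. An $\mathbf{ILX}$-theory is a set containing $\mathbf{ILX}$ closed under modus ponens and necessitation; an $\mathbf{ILX}$-MCS is a maximal $\mathbf{ILX}$-consistent set. $\Gamma\prec_S\Delta$ iff for every formula $A$ and finite $S'\subseteq S$, $\neg A\rhd\bigvee_{\sigma\in S'}\neg\sigma\in\Gamma$ implies $A,\Box A\in\Delta$ (empty disjunction is $\bot$). -}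

module Defs where

open import Data.Nat using (ℕ)
open import Data.Bool using (Bool; true; false; _∧_; not; _∨_)
open import Data.List using (List; []; _∷_)
open import Data.List.Relation.Unary.All using (All)
open import Data.Product using (Σ; _×_)
open import Relation.Binary.PropositionalEquality using (_≡_)
open import Relation.Nullary using (¬_)

infixr 6 _⇒_
infix 7 _▷_

data Formula : Set where
  var : ℕ → Formula
  ⊥'  : Formula
  _⇒_ : Formula → Formula → Formula
  □   : Formula → Formula
  _▷_ : Formula → Formula → Formula

~_ : Formula → Formula
~ A = A ⇒ ⊥'

⊤' : Formula
⊤' = ~ ⊥'

_∨'_ : Formula → Formula → Formula
A ∨' B = (~ A) ⇒ B

_∧'_ : Formula → Formula → Formula
A ∧' B = ~ (A ⇒ ~ B)

◇ : Formula → Formula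
◇ A = ~ (□ (~ A))

⋁ : List Formula → Formula
⋁ []           = ⊥'
⋁ (A ∷ [])     = A
⋁ (A ∷ B ∷ Bs) = A ∨' ⋁ (B ∷ Bs)

⋀ : List Formula → Formula
⋀ []           = ⊤'
⋀ (A ∷ [])     = A
⋀ (A ∷ B ∷ Bs) = A ∧' ⋀ (B ∷ Bs)

mapNeg : List Formula → List Formula
mapNeg []       = []
mapNeg (A ∷ As) = ~ A ∷ mapNeg As

-- Classical tautologies: true under every Boolean valuation that treats
-- variables, □-formulas and ▷-formulas as propositional atoms.
eval : (Formula → Bool) → Formula → Bool
eval v (var n)   = v (var n)
eval v ⊥'        = false
eval v (A ⇒ B)   = not (eval v A) ∨ eval v B
eval v (□ A)     = v (□ A)
eval v (A ▷ B)   = v (A ▷ B)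

Tautology : Formula → Set
Tautology A = (v : Formula → Bool) → eval v A ≡ true

data IL : Formula → Set where
  taut : ∀ {A} → Tautology A → IL A
  axK  : ∀ {A B} → IL (□ (A ⇒ B) ⇒ (□ A ⇒ □ B))
  axL  : ∀ {A} → IL (□ (□ A ⇒ A) ⇒ □ A)
  axJ1 : ∀ {A B} → IL (□ (A ⇒ B) ⇒ A ▷ B)
  axJ2 : ∀ {A B C} → IL ((A ▷ B) ∧' (B ▷ C) ⇒ A ▷ C)
  axJ3 : ∀ {A B C} → IL ((A ▷ C) ∧' (B ▷ C) ⇒ (A ∨' B) ▷ C)
  axJ4 : ∀ {A B} → IL (A ▷ B ⇒ (◇ A ⇒ ◇ B))
  axJ5 : ∀ {A} → IL (◇ A ▷ A)
  mp   : ∀ {A B} → IL (A ⇒ B) → IL A → IL B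
  nec  : ∀ {A} → IL A → IL (□ A)

FSet : Set₁
FSet = Formula → Set

_⊆_ : FSet → FSet → Set
P ⊆ Q = ∀ {A} → P A → Q A

record Logic : Set₁ where
  field
    thm     : FSet
    IL⊆     : IL ⊆ thm
    closeMP : ∀ {A B} → thm (A ⇒ B) → thm A → thm B
    closeNec : ∀ {A} → thm A → thm (□ A)
open Logic public

record Theory (X : Logic) (S : FSet) : Set where
  field
    contains : thm X ⊆ S
    thMP     : ∀ {A B} → S (A ⇒ B) → S A → S B
    thNec    : ∀ {A} → S A → S (□ A)

Consistent : Logic → FSet → Set
Consistent X Γ = (γs : List Formula) → All Γ γs → ¬ thm X (⋀ γs ⇒ ⊥')

MCS : Logic → FSet → Set₁
MCS X Γ = Consistent X Γ × ((Θ : FSet) → Consistent X Θ → Γ ⊆ Θ → Θ ⊆ Γ)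

Prec : FSet → FSet → FSet → Set
Prec Γ S Δ = (A : Formula) (S' : List Formula) → All S S' →
  Γ (~ A ▷ ⋁ (mapNeg S')) → Δ A × Δ (□ A)

module Submission where

-- With excluded middle the usual Lindenbaum-style greedy argument goes
-- through.  Formulas are enumerated by an increasing sequence of finite
-- layers.  Starting from S we sweep through layer after layer, adding a
-- formula whenever the theory generated by what we have so far plus that
-- formula still satisfies Γ ≺ · Δ.  The result S* is the theory generated by
-- the union of all stages.
--   * Γ ≺_{S*} Δ holds because ≺ only inspects finitely many formulas of S*,
--     and derivations are finite, so everything it inspects already lives in
--     the theory generated by a single stage (compactness of the closure).
--   * S* is maximal: if U ⊇ S* is a good theory and A ∈ U, then when A was
--     considered, adding it was allowed (U itself witnesses it), so A ∈ S*.

open import Defs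
open import Level using (0ℓ)
open import Axiom.ExcludedMiddle using (ExcludedMiddle)
open import Data.Product using (Σ; _×_; _,_)
open import Data.Sum using (_⊎_; inj₁; inj₂)
open import Data.Nat using (ℕ; zero; suc; _≤_; _⊔_; _≤′_; ≤′-refl; ≤′-step)
open import Data.Nat.Properties using (≤⇒≤′; m≤m⊔n; m≤n⊔m)
open import Data.List using (List; []; _∷_; [_]; _++_; map; foldl; cartesianProductWith)
open import Data.List.Relation.Unary.All as All using (All; []; _∷_)
open import Data.List.Relation.Unary.Any using (here; there)
open import Data.List.Membership.Propositional using (_∈_)
open import Data.List.Membership.Propositional.Properties
  using (∈-map⁺; ∈-++⁺ˡ; ∈-++⁺ʳ; ∈-cartesianProductWith⁺)
open import Relation.Binary.PropositionalEquality using (_≡_; refl)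
open import Relation.Nullary using (yes; no)
open import Data.Empty using (⊥-elim)

Chain : (ℕ → FSet) → Set
Chain T = ∀ n → T n ⊆ T (suc n)

⋃ : (ℕ → FSet) → FSet
⋃ T A = Σ ℕ (λ n → T n A)

chain-mono : ∀ {T} → Chain T → ∀ {m n} → m ≤ n → T m ⊆ T n
chain-mono {T} step m≤n = go (≤⇒≤′ m≤n)
  where
  go : ∀ {m n} → m ≤′ n → T m ⊆ T n
  go ≤′-refl          t = t
  go (≤′-step {n} le) t = step n (go le t)

chain-⊔ˡ : ∀ {T} → Chain T → ∀ m n → T m ⊆ T (m ⊔ n)
chain-⊔ˡ step m n = chain-mono step (m≤m⊔n m n)

chain-⊔ʳ : ∀ {T} → Chain T → ∀ m n → T n ⊆ T (m ⊔ n)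
chain-⊔ʳ step m n = chain-mono step (m≤n⊔m m n)

chain-finite : ∀ {T} → Chain T → ∀ {As} → All (⋃ T) As → Σ ℕ (λ n → All (T n) As)
chain-finite step []             = zero , []
chain-finite step ((m , t) ∷ ts) with chain-finite step ts
... | n , ts′ = m ⊔ n , (chain-⊔ˡ step m n t ∷ All.map (chain-⊔ʳ step m n) ts′)

built : List Formula → List Formula
built As = map □ As ++ cartesianProductWith _⇒_ As As ++ cartesianProductWith _▷_ As As

layer : ℕ → List Formula
layer zero    = [ ⊥' ]
layer (suc n) = layer n ++ var n ∷ built (layer n)

Listed : ℕ → FSet
Listed n A = A ∈ layer n

listed-chain : Chain Listed
listed-chain n = ∈-++⁺ˡ

listed-built : ∀ n {A} → A ∈ built (layer n) → Listed (suc n) A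
listed-built n i = ∈-++⁺ʳ (layer n) (there i)

listed-all : ∀ A → ⋃ Listed A
listed-all (var n) = suc n , ∈-++⁺ʳ (layer n) (here refl)
listed-all ⊥'      = zero , here refl
listed-all (□ A) with listed-all A
... | n , i = suc n , listed-built n (∈-++⁺ˡ (∈-map⁺ □ i))
listed-all (A ⇒ B) with listed-all A | listed-all B
... | m , i | n , j = suc (m ⊔ n) , listed-built (m ⊔ n)
  (∈-++⁺ʳ (map □ (layer (m ⊔ n))) (∈-++⁺ˡ
    (∈-cartesianProductWith⁺ _⇒_ (chain-⊔ˡ listed-chain m n i) (chain-⊔ʳ listed-chain m n j))))
listed-all (A ▷ B) with listed-all A | listed-all B
... | m , i | n , j = suc (m ⊔ n) , listed-built (m ⊔ n)
  (∈-++⁺ʳ (map □ (layer (m ⊔ n))) (∈-++⁺ʳ (cartesianProductWith _⇒_ (layer (m ⊔ n)) (layer (m ⊔ n)))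
    (∈-cartesianProductWith⁺ _▷_ (chain-⊔ˡ listed-chain m n i) (chain-⊔ʳ listed-chain m n j))))

data Cl (X : Logic) (B : FSet) : FSet where
  base : ∀ {A} → B A → Cl X B A
  ax   : ∀ {A} → thm X A → Cl X B A
  cmp  : ∀ {A C} → Cl X B (A ⇒ C) → Cl X B A → Cl X B C
  cnec : ∀ {A} → Cl X B A → Cl X B (□ A)

Cl-theory : ∀ {X B} → Theory X (Cl X B)
Cl-theory = record { contains = ax ; thMP = cmp ; thNec = cnec }

Cl-least : ∀ {X B U} → Theory X U → B ⊆ U → Cl X B ⊆ U
Cl-least T B⊆U (base b)  = B⊆U b
Cl-least T B⊆U (ax t)    = Theory.contains T t
Cl-least T B⊆U (cmp d e) = Theory.thMP T (Cl-least T B⊆U d) (Cl-least T B⊆U e)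
Cl-least T B⊆U (cnec d)  = Theory.thNec T (Cl-least T B⊆U d)

Cl-mono : ∀ {X B C} → B ⊆ C → Cl X B ⊆ Cl X C
Cl-mono {X} {C = C} B⊆C = Cl-least (Cl-theory {X} {C}) (λ b → base (B⊆C b))

Cl-chain : ∀ {X T} → Chain T → Chain (λ n → Cl X (T n))
Cl-chain step n = Cl-mono (step n)

Cl-compact : ∀ {X T} → Chain T → Cl X (⋃ T) ⊆ ⋃ (λ n → Cl X (T n))
Cl-compact step (base (n , t)) = n , base t
Cl-compact step (ax t)         = zero , ax t
Cl-compact {X} step (cmp d e) with Cl-compact step d | Cl-compact step e
... | m , d′ | n , e′ = m ⊔ n ,
  cmp (chain-⊔ˡ (Cl-chain {X} step) m n d′) (chain-⊔ʳ (Cl-chain {X} step) m n e′)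
Cl-compact step (cnec d) with Cl-compact step d
... | n , d′ = n , cnec d′

Prec-antitone : ∀ Γ Δ {V W} → V ⊆ W → Prec Γ W Δ → Prec Γ V Δ
Prec-antitone Γ Δ V⊆W prec A Ss Ss⊆V = prec A Ss (All.map V⊆W Ss⊆V)

-- Γ ≺ · Δ is preserved by unions of chains, since it inspects finite sets.
Prec-⋃ : ∀ Γ Δ {T} → Chain T → (∀ n → Prec Γ (T n) Δ) → Prec Γ (⋃ T) Δ
Prec-⋃ Γ Δ step prec A Ss Ss⊆⋃ with chain-finite step Ss⊆⋃
... | n , Ss⊆Tn = prec n A Ss Ss⊆Tn

module Greedy (em : ExcludedMiddle 0ℓ) (Good : FSet → Set)
              (Good-antitone : ∀ {V W} → V ⊆ W → Good W → Good V) where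

  insert : FSet → Formula → FSet
  insert B A C = B C ⊎ A ≡ C

  step : FSet → Formula → FSet
  step B A with em {Good (insert B A)}
  ... | yes _ = insert B A
  ... | no _  = B

  step-⊇ : ∀ B A → B ⊆ step B A
  step-⊇ B A with em {Good (insert B A)}
  ... | yes _ = inj₁
  ... | no _  = λ b → b

  step-good : ∀ B A → Good B → Good (step B A)
  step-good B A good with em {Good (insert B A)}
  ... | yes good′ = good′
  ... | no _      = good

  step-adds : ∀ {W} → Good W → ∀ B A → B ⊆ W → W A → step B A A
  step-adds {W} goodW B A B⊆W a with em {Good (insert B A)}
  ... | yes _   = inj₂ refl
  ... | no bad  = ⊥-elim (bad (Good-antitone insert⊆W goodW))
    where
    insert⊆W : insert B A ⊆ W
    insert⊆W (inj₁ b)    = B⊆W b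
    insert⊆W (inj₂ refl) = a

  sweep : FSet → List Formula → FSet
  sweep = foldl step

  sweep-⊇ : ∀ B As → B ⊆ sweep B As
  sweep-⊇ B []       b = b
  sweep-⊇ B (A ∷ As) b = sweep-⊇ (step B A) As (step-⊇ B A b)

  sweep-good : ∀ B As → Good B → Good (sweep B As)
  sweep-good B []       good = good
  sweep-good B (A ∷ As) good = sweep-good (step B A) As (step-good B A good)

  sweep-adds : ∀ {W} → Good W → ∀ B As {A} → A ∈ As → W A → sweep B As ⊆ W → sweep B As A
  sweep-adds goodW B (A ∷ As) (here refl) a sweep⊆W =
    sweep-⊇ (step B A) As (step-adds goodW B A (λ b → sweep⊆W (sweep-⊇ (step B A) As (step-⊇ B A b))) a)
  sweep-adds goodW B (C ∷ As) (there i) a sweep⊆W = sweep-adds goodW (step B C) As i a sweep⊆W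

module MaximalExtension (em : ExcludedMiddle 0ℓ) (X : Logic) (Γ Δ S : FSet)
                        (S-theory : Theory X S) (S-prec : Prec Γ S Δ) where

  Good : FSet → Set
  Good B = Prec Γ (Cl X B) Δ

  Good-antitone : ∀ {V W} → V ⊆ W → Good W → Good V
  Good-antitone V⊆W = Prec-antitone Γ Δ (Cl-mono V⊆W)

  theory-good : ∀ {U} → Theory X U → Prec Γ U Δ → Good U
  theory-good U-theory = Prec-antitone Γ Δ (Cl-least U-theory (λ u → u))

  open Greedy em Good Good-antitone

  stage : ℕ → FSet
  stage zero    = S
  stage (suc n) = sweep (stage n) (layer n)

  stage-chain : Chain stage
  stage-chain n = sweep-⊇ (stage n) (layer n)

  stage-good : ∀ n → Good (stage n)
  stage-good zero    = theory-good S-theory S-prec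
  stage-good (suc n) = sweep-good (stage n) (layer n) (stage-good n)

  S* : FSet
  S* = Cl X (⋃ stage)

  S*-prec : Prec Γ S* Δ
  S*-prec = Prec-antitone Γ Δ (Cl-compact stage-chain)
    (Prec-⋃ Γ Δ (Cl-chain {X} stage-chain) stage-good)

  S*-maximal : (U : FSet) → Theory X U → Prec Γ U Δ → S* ⊆ U → U ⊆ S*
  S*-maximal U U-theory U-prec S*⊆U {A} a with listed-all A
  ... | n , i = base (suc n ,
    sweep-adds (theory-good U-theory U-prec) (stage n) (layer n) i a (λ s → S*⊆U (base (suc n , s))))

-- Lemma 4.17.  The construction does not need Γ and Δ to be maximal consistent.

lemma4p17 : ExcludedMiddle 0ℓ → (X : Logic) (Γ Δ S : FSet) →
    MCS X Γ → MCS X Δ → Theory X S → Prec Γ S Δ →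
    Σ FSet (λ S' → S ⊆ S' × Theory X S' × Prec Γ S' Δ ×
    ((U : FSet) → Theory X U → Prec Γ U Δ → S' ⊆ U → U ⊆ S'))
lemma4p17 em X Γ Δ S _ _ S-theory S-prec =
  S* , (λ s → base (zero , s)) , Cl-theory , S*-prec , S*-maximal
  where open MaximalExtension em X Γ Δ S S-theory S-prec
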